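{- If $G$ is a finite simple graph with $n\ge 1$ vertices that is $2K_2$-free (no induced subgraph of $G$ is isomorphic to two disjoint edges), then $\theta(G)\leq 2\log_2 n$.
   Context: For a finite simple graph $G$, $\theta(G)$ is defined recursively by: $\theta(G)=0$ if $G$ has no edges, and otherwise $\theta(G)=\min_{v}\max\{\theta(G-v),\ \theta(G-N_G[v])+1\}$, the minimum over non-isolated vertices $v$ of $G$, where $N_G[v]$ is the closed neighborhood of $v$. (This equals the theta-number of the independence complex of $G$.) -}

module Defs where

open import Data.Nat using (ℕ; zero; suc; _⊔_; _⊓_)
open import Data.Bool using (Bool; true; false; _∧_; not)
open import Data.Fin using (Fin)
open import Data.Fin.Properties using (_≟_)
open import Data.Vec using (lookup; tabulate)
open import Data.Fin.Subset using (Subset; ⊤)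
open import Data.List using (List; []; _∷_; map; filter; foldr)
open import Data.Bool.ListAction using (any)
open import Data.List using () renaming (allFin to allFinL)
open import Data.Bool using (T)
open import Relation.Nullary.Decidable using (⌊_⌋; T?)
open import Relation.Binary.PropositionalEquality using (_≡_)

record Graph (n : ℕ) : Set where
  field
    adj   : Fin n → Fin n → Bool
    sym   : ∀ u v → adj u v ≡ adj v u
    irrefl : ∀ v → adj v v ≡ false
open Graph public

module _ {n : ℕ} (G : Graph n) where

  nonIsolated : Subset n → Fin n → Bool
  nonIsolated S v = lookup S v ∧ any (λ u → lookup S u ∧ adj G v u) (allFinL n)

  delete : Subset n → Fin n → Subset n
  delete S v = tabulate (λ u → lookup S u ∧ not ⌊ u ≟ v ⌋)

  deleteN : Subset n → Fin n → Subset n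
  deleteN S v = tabulate (λ u → lookup S u ∧ not ⌊ u ≟ v ⌋ ∧ not (adj G v u))

  -- minimum of a list (0 for the empty list, i.e. when there are no edges)
  minL : List ℕ → ℕ
  minL []       = 0
  minL (x ∷ xs) = foldr _⊓_ x xs

  -- Each recursive step removes at least one vertex of S, so fuel n suffices.
  -- If G[S] has no edges, there are no non-isolated vertices and minL [] = 0.
  θ-aux : ℕ → Subset n → ℕ
  θ-aux zero    S = 0
  θ-aux (suc k) S =
    minL (map (λ v → θ-aux k (delete S v) ⊔ suc (θ-aux k (deleteN S v)))
              (filter (λ v → T? (nonIsolated S v)) (allFinL n)))

  θ : ℕ
  θ = θ-aux n ⊤

  -- G is 2K₂-free: no two edges ab, cd with no edges between {a,b} and {c,d}
  -- (such a configuration automatically has 4 distinct vertices, so this is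
  -- exactly: no induced subgraph isomorphic to 2K₂).
  2K₂-free : Set
  2K₂-free = ∀ a b c d → adj G a b ≡ true → adj G c d ≡ true →
             adj G a c ≡ false → adj G a d ≡ false →
             adj G b c ≡ false → adj G b d ≡ false → Data.Empty.⊥
    where import Data.Empty

{-# OPTIONS --safe #-}
-- Let E(S) be the number of ordered pairs of adjacent vertices of G[S]. Branching at a vertex
-- v of maximum degree Δ, we show 2 ^ θ(G[S]) ≤ max(1, E(S)); as E ≤ n², this is the theorem.
-- Deleting v does not increase E. For H = S ∖ N[v], let z₀ be a neighbour of v with the fewest,
-- say c, neighbours in H. Every neighbour of v has at least c neighbours in H, so at least Δ·c
-- edges join N(v) to H. As v z₀ is an edge and v has no neighbour in H, 2K₂-freeness forces
-- every edge of H to meet N(z₀), and degrees are at most Δ, so E(H) ≤ 2·c·Δ. Adding up the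
-- edges inside H, between H and N(v), and at v gives 2·(E(H) + 1) ≤ E(S).
module Submission where

open import Defs hiding (sym)
open import Data.Bool.Base using (Bool; true; false; _∧_; not; T)
open import Data.Bool.Properties using (T-∧; T-≡; ∧-assoc; ∧-comm)
open import Data.Empty using (⊥-elim)
open import Data.Fin.Base using (Fin; zero; suc)
open import Data.Fin.Properties using (_≟_)
open import Data.Fin.Subset using (Subset; ⊤)
open import Data.List.Base using (List; []; _∷_; map; filter; allFin)
open import Data.List.Extrema.Nat using (argmax; argmin; argmax-sel; argmin-sel; f[xs]≤f[argmax]; f[argmin]≤f[xs])
open import Data.List.Membership.Propositional using (_∈_; lose)
open import Data.List.Membership.Propositional.Properties using (∈-filter⁺; ∈-filter⁻; ∈-allFin)
open import Data.List.Properties using (foldr-preservesᵒ)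
import Data.List.Relation.Unary.All as All
open import Data.List.Relation.Unary.Any as Any using (Any; here; there; satisfied)
open import Data.List.Relation.Unary.Any.Properties using (any⁺; any⁻; map⁺)
open import Data.Nat.Base using (ℕ; zero; suc; _+_; _*_; _^_; _≤_; _⊔_; z≤n)
open import Data.Nat.Properties hiding (_≟_)
open import Data.Nat.Tactic.RingSolver using (solve-∀)
open import Data.Product.Base using (∃-syntax; _×_; _,_; proj₁; proj₂; uncurry)
open import Data.Sum.Base using (_⊎_; inj₁; inj₂; [_,_])
open import Data.Unit.Base using (tt)
open import Data.Vec.Base using (lookup)
open import Data.Vec.Properties using (lookup∘tabulate)
open import Function.Base using (_∘_)
open import Function.Bundles using (module Equivalence)
open import Relation.Binary.PropositionalEquality using (_≡_; refl; sym; trans; cong; cong₂; subst; module ≡-Reasoning)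
open import Relation.Nullary.Decidable using (⌊_⌋; T?; fromWitness; toWitness)
open import Relation.Unary using (_⊆_)
open import Algebra.Properties.Semiring.Sum +-*-semiring using (sum; ∑-distrib-+; ∑-comm; *-distribˡ-sum; *-distribʳ-sum; sum-cong-≗)

open Equivalence using (to; from)

sum-mono-≤ : ∀ {n} {f g : Fin n → ℕ} → (∀ i → f i ≤ g i) → sum f ≤ sum g
sum-mono-≤ {zero}  f≤g = z≤n
sum-mono-≤ {suc n} f≤g = +-mono-≤ (f≤g zero) (sum-mono-≤ (f≤g ∘ suc))

f[i]≤sum : ∀ {n} (f : Fin n → ℕ) i → f i ≤ sum f
f[i]≤sum f zero    = m≤m+n _ _
f[i]≤sum f (suc i) = ≤-trans (f[i]≤sum (f ∘ suc) i) (m≤n+m _ _)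

𝟙 : Bool → ℕ
𝟙 true  = 1
𝟙 false = 0

𝟙≤1 : ∀ x → 𝟙 x ≤ 1
𝟙≤1 true  = ≤-refl
𝟙≤1 false = z≤n

𝟙-∧ : ∀ x y → 𝟙 (x ∧ y) ≡ 𝟙 x * 𝟙 y
𝟙-∧ true  y = sym (*-identityˡ (𝟙 y))
𝟙-∧ false y = refl

1≤𝟙 : ∀ {x} → T x → 1 ≤ 𝟙 x
1≤𝟙 {true} _ = ≤-refl

𝟙-∧-monoˡ : ∀ {x x′} e → (T x → T x′) → 𝟙 (x ∧ e) ≤ 𝟙 (x′ ∧ e)
𝟙-∧-monoˡ {false}          e _   = z≤n
𝟙-∧-monoˡ {true}  {true}   e _   = ≤-refl
𝟙-∧-monoˡ {true}  {false}  e x⇒x′ = ⊥-elim (x⇒x′ tt)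

𝟙-∧-mono : ∀ {x x′ y y′} e → (T x → T x′) → (T y → T y′) → 𝟙 (x ∧ y ∧ e) ≤ 𝟙 (x′ ∧ y′ ∧ e)
𝟙-∧-mono {false}                 e _    _    = z≤n
𝟙-∧-mono {true}  {true}          e _    y⇒y′ = 𝟙-∧-monoˡ e y⇒y′
𝟙-∧-mono {true}  {false}         e x⇒x′ _    = ⊥-elim (x⇒x′ tt)

𝟙-*-mono : ∀ x {m n} → (T x → m ≤ n) → 𝟙 x * m ≤ 𝟙 x * n
𝟙-*-mono true  m≤n = *-monoʳ-≤ 1 (m≤n tt)
𝟙-*-mono false _   = z≤n

𝟙-cover : ∀ x y z → (T x → T y ⊎ T z) → 𝟙 x ≤ 𝟙 y + 𝟙 z
𝟙-cover false _ _ _     = z≤n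
𝟙-cover true  y z cover with cover tt
... | inj₁ ty = ≤-trans (1≤𝟙 ty) (m≤m+n _ _)
... | inj₂ tz = ≤-trans (1≤𝟙 tz) (m≤n+m _ _)

∣_∣ : ∀ {n} → (Fin n → Bool) → ℕ
∣ p ∣ = sum (𝟙 ∘ p)

∣p∣≤n : ∀ {n} (p : Fin n → Bool) → ∣ p ∣ ≤ n
∣p∣≤n {zero}  p = z≤n
∣p∣≤n {suc n} p = +-mono-≤ (𝟙≤1 (p zero)) (∣p∣≤n (p ∘ suc))

module _ {n : ℕ} (p : Fin n → Bool) (f : Fin n → ℕ) {x : Fin n} (px : T (p x)) where

  private
    xs : List (Fin n)
    xs = filter (T? ∘ p) (allFin n)

    ∈xs : ∀ {u} → T (p u) → u ∈ xs
    ∈xs pu = ∈-filter⁺ (T? ∘ p) (∈-allFin _) pu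

    selected : ∀ {v} → v ≡ x ⊎ v ∈ xs → T (p v)
    selected = [ (λ { refl → px }) , proj₂ ∘ ∈-filter⁻ (T? ∘ p) {xs = allFin n} ]

  ∃-argmax : ∃[ v ] T (p v) × (∀ u → T (p u) → f u ≤ f v)
  ∃-argmax = argmax f x xs , selected (argmax-sel f x xs) ,
             λ u pu → All.lookup (f[xs]≤f[argmax] x xs) (∈xs pu)

  ∃-argmin : ∃[ v ] T (p v) × (∀ u → T (p u) → f v ≤ f u)
  ∃-argmin = argmin f x xs , selected (argmin-sel f x xs) ,
             λ u pu → All.lookup (f[argmin]≤f[xs] x xs) (∈xs pu)

module _ {n : ℕ} (G : Graph n) where

  deg : (Fin n → Bool) → Fin n → ℕ
  deg p a = ∣ (λ b → p b ∧ adj G a b) ∣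

  -- Ordered pairs: edgeCount S is twice the number of edges of G[S].
  edges : (Fin n → Bool) → (Fin n → Bool) → ℕ
  edges p q = sum λ a → sum λ b → 𝟙 (p a ∧ q b ∧ adj G a b)

  edgeCount : Subset n → ℕ
  edgeCount S = edges (lookup S) (lookup S)

  deg-mono : ∀ {p q} → T ∘ p ⊆ T ∘ q → ∀ a → deg p a ≤ deg q a
  deg-mono p⊆q a = sum-mono-≤ λ b → 𝟙-∧-monoˡ (adj G a b) p⊆q

  edges-mono : ∀ {p p′ q q′} → T ∘ p ⊆ T ∘ p′ → T ∘ q ⊆ T ∘ q′ → edges p q ≤ edges p′ q′
  edges-mono p⊆p′ q⊆q′ = sum-mono-≤ λ a → sum-mono-≤ λ b → 𝟙-∧-mono (adj G a b) p⊆p′ q⊆q′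

  edges-comm : ∀ p q → edges p q ≡ edges q p
  edges-comm p q = trans (∑-comm (λ a b → 𝟙 (p a ∧ q b ∧ adj G a b))) (sum-cong-≗ λ b → sum-cong-≗ λ a →
    cong 𝟙 (begin
      p a ∧ q b ∧ adj G a b    ≡⟨ sym (∧-assoc (p a) (q b) _) ⟩
      (p a ∧ q b) ∧ adj G a b  ≡⟨ cong₂ _∧_ (∧-comm (p a) (q b)) (Graph.sym G a b) ⟩
      (q b ∧ p a) ∧ adj G b a  ≡⟨ ∧-assoc (q b) (p a) _ ⟩
      q b ∧ p a ∧ adj G b a    ∎))
    where open ≡-Reasoning

  edges-by-degree : ∀ p q → edges p q ≡ sum λ a → 𝟙 (p a) * deg q a
  edges-by-degree p q = sum-cong-≗ λ a → sym (begin
    𝟙 (p a) * deg q a                              ≡⟨ *-distribˡ-sum (𝟙 (p a)) (λ b → 𝟙 (q b ∧ adj G a b)) ⟩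
    sum (λ b → 𝟙 (p a) * 𝟙 (q b ∧ adj G a b))     ≡⟨ sum-cong-≗ (λ b → sym (𝟙-∧ (p a) (q b ∧ adj G a b))) ⟩
    sum (λ b → 𝟙 (p a ∧ q b ∧ adj G a b))         ∎)
    where open ≡-Reasoning

  edges-split₃ˡ : ∀ {x y z w} q → (∀ a → 𝟙 (x a) + 𝟙 (y a) + 𝟙 (z a) ≤ 𝟙 (w a)) →
                  edges x q + edges y q + edges z q ≤ edges w q
  edges-split₃ˡ {x} {y} {z} {w} q partition = begin
    edges x q + edges y q + edges z q
      ≡⟨ cong₂ _+_ (cong₂ _+_ (edges-by-degree x q) (edges-by-degree y q)) (edges-by-degree z q) ⟩
    sum (λ a → X a * d a) + sum (λ a → Y a * d a) + sum (λ a → Z a * d a)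
      ≡⟨ cong (_+ sum (λ a → Z a * d a)) (sym (∑-distrib-+ (λ a → X a * d a) _)) ⟩
    sum (λ a → X a * d a + Y a * d a) + sum (λ a → Z a * d a)
      ≡⟨ sym (∑-distrib-+ (λ a → X a * d a + Y a * d a) _) ⟩
    sum (λ a → X a * d a + Y a * d a + Z a * d a)
      ≡⟨ sum-cong-≗ (λ a → sym (trans (*-distribʳ-+ (d a) (X a + Y a) (Z a))
                                       (cong (_+ Z a * d a) (*-distribʳ-+ (d a) (X a) (Y a))))) ⟩
    sum (λ a → (X a + Y a + Z a) * d a)
      ≤⟨ sum-mono-≤ (λ a → *-monoˡ-≤ (d a) (partition a)) ⟩
    sum (λ a → 𝟙 (w a) * d a)
      ≡⟨ edges-by-degree w q ⟨
    edges w q ∎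
    where
    open ≤-Reasoning
    X Y Z : Fin n → ℕ
    X = 𝟙 ∘ x
    Y = 𝟙 ∘ y
    Z = 𝟙 ∘ z
    d : Fin n → ℕ
    d = deg q

  edges-split₃ʳ : ∀ {x y z w} p → (∀ a → 𝟙 (x a) + 𝟙 (y a) + 𝟙 (z a) ≤ 𝟙 (w a)) →
                  edges p x + edges p y + edges p z ≤ edges p w
  edges-split₃ʳ {x} {y} {z} {w} p partition
    rewrite edges-comm p x | edges-comm p y | edges-comm p z | edges-comm p w =
    edges-split₃ˡ {x} {y} {z} {w} p partition

  edges-≤ : ∀ {p q k} → (∀ a → T (p a) → deg q a ≤ k) → edges p q ≤ ∣ p ∣ * k
  edges-≤ {p} {q} {k} deg≤k = begin
    edges p q                       ≡⟨ edges-by-degree p q ⟩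
    sum (λ a → 𝟙 (p a) * deg q a)  ≤⟨ sum-mono-≤ (λ a → 𝟙-*-mono (p a) (deg≤k a)) ⟩
    sum (λ a → 𝟙 (p a) * k)        ≡⟨ *-distribʳ-sum k (𝟙 ∘ p) ⟨
    ∣ p ∣ * k                       ∎
    where open ≤-Reasoning

  edges-≥ : ∀ {p q k} → (∀ a → T (p a) → k ≤ deg q a) → ∣ p ∣ * k ≤ edges p q
  edges-≥ {p} {q} {k} k≤deg = begin
    ∣ p ∣ * k                       ≡⟨ *-distribʳ-sum k (𝟙 ∘ p) ⟩
    sum (λ a → 𝟙 (p a) * k)        ≤⟨ sum-mono-≤ (λ a → 𝟙-*-mono (p a) (k≤deg a)) ⟩
    sum (λ a → 𝟙 (p a) * deg q a)  ≡⟨ edges-by-degree p q ⟨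
    edges p q                       ∎
    where open ≤-Reasoning

  edge⇒1≤edges : ∀ {p q a b} → T (p a) → T (q b) → T (adj G a b) → 1 ≤ edges p q
  edge⇒1≤edges {p} {q} {a} {b} pa qb ab =
    ≤-trans (1≤𝟙 (from T-∧ (pa , from T-∧ (qb , ab))))
    (≤-trans (f[i]≤sum (λ b → 𝟙 (p a ∧ q b ∧ adj G a b)) b)
             (f[i]≤sum (λ a → sum λ b → 𝟙 (p a ∧ q b ∧ adj G a b)) a))

  edges-cover : ∀ {p q p′ q′} → (∀ a b → T (p a) → T (q b) → T (adj G a b) → T (p′ a) ⊎ T (q′ b)) →
                edges p q ≤ edges p′ q + edges p q′
  edges-cover {p} {q} {p′} {q′} cover = begin
    edges p q
      ≤⟨ sum-mono-≤ (λ a → sum-mono-≤ λ b → 𝟙-cover _ _ _ (covered a b)) ⟩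
    sum (λ a → sum λ b → 𝟙 (p′ a ∧ q b ∧ adj G a b) + 𝟙 (p a ∧ q′ b ∧ adj G a b))
      ≡⟨ sum-cong-≗ (λ a → ∑-distrib-+ (λ b → 𝟙 (p′ a ∧ q b ∧ adj G a b)) _) ⟩
    sum (λ a → sum (λ b → 𝟙 (p′ a ∧ q b ∧ adj G a b)) + sum (λ b → 𝟙 (p a ∧ q′ b ∧ adj G a b)))
      ≡⟨ ∑-distrib-+ (λ a → sum λ b → 𝟙 (p′ a ∧ q b ∧ adj G a b)) _ ⟩
    edges p′ q + edges p q′ ∎
    where
    open ≤-Reasoning
    covered : ∀ a b → T (p a ∧ q b ∧ adj G a b) → T (p′ a ∧ q b ∧ adj G a b) ⊎ T (p a ∧ q′ b ∧ adj G a b)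
    covered a b t with to T-∧ t
    ... | pa , qb∧ab with to T-∧ qb∧ab
    ...   | qb , ab = [ (λ p′a → inj₁ (from T-∧ (p′a , qb∧ab))) ,
                        (λ q′b → inj₂ (from T-∧ (pa , from T-∧ (q′b , ab)))) ] (cover a b pa qb ab)

  ∈-deleteN : ∀ S v a → T (lookup (deleteN G S v) a) → T (lookup S a) × adj G v a ≡ false
  ∈-deleteN S v a rewrite lookup∘tabulate (λ u → lookup S u ∧ not ⌊ u ≟ v ⌋ ∧ not (adj G v u)) a =
    outside (lookup S a) ⌊ a ≟ v ⌋ (adj G v a)
    where
    outside : ∀ s d e → T (s ∧ not d ∧ not e) → T s × e ≡ false
    outside true false false _ = tt , refl

  deleteN-partition : ∀ S v → T (lookup S v) → ∀ a →
    𝟙 (lookup (deleteN G S v) a) + 𝟙 (lookup S a ∧ adj G v a) + 𝟙 ⌊ a ≟ v ⌋ ≤ 𝟙 (lookup S a)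
  deleteN-partition S v v∈S a rewrite lookup∘tabulate (λ u → lookup S u ∧ not ⌊ u ≟ v ⌋ ∧ not (adj G v u)) a =
    trichotomy (lookup S a) ⌊ a ≟ v ⌋ (adj G v a) at-v
    where
    at-v : T ⌊ a ≟ v ⌋ → T (lookup S a) × adj G v a ≡ false
    at-v a≡v with toWitness a≡v
    ... | refl = v∈S , irrefl G v
    trichotomy : ∀ s d e → (T d → T s × e ≡ false) → 𝟙 (s ∧ not d ∧ not e) + 𝟙 (s ∧ e) + 𝟙 d ≤ 𝟙 s
    trichotomy true  false false _ = ≤-refl
    trichotomy true  false true  _ = ≤-refl
    trichotomy true  true  false _ = ≤-refl
    trichotomy true  true  true  d⇒ with () ← proj₂ (d⇒ tt)
    trichotomy false false e     _ = z≤n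
    trichotomy false true  e     d⇒ = ⊥-elim (proj₁ (d⇒ tt))

  edges≤n*n : ∀ p q → edges p q ≤ n * n
  edges≤n*n p q = ≤-trans (edges-≤ (λ a _ → ∣p∣≤n _)) (*-monoˡ-≤ n (∣p∣≤n p))

  ∈-delete : ∀ S v → T ∘ lookup (delete G S v) ⊆ T ∘ lookup S
  ∈-delete S v {a} rewrite lookup∘tabulate (λ u → lookup S u ∧ not ⌊ u ≟ v ⌋) a = proj₁ ∘ to T-∧

  nonIsolated⇒neighbour : ∀ S {v} → T (nonIsolated G S v) → ∃[ z ] T (lookup S z ∧ adj G v z)
  nonIsolated⇒neighbour S {v} t =
    satisfied (any⁻ (λ u → lookup S u ∧ adj G v u) (allFin n) (proj₂ (to T-∧ t)))

  edge⇒nonIsolated : ∀ S {u w} → T (lookup S u) → T (lookup S w) → T (adj G u w) → T (nonIsolated G S u)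
  edge⇒nonIsolated S {u} su sw uw = from T-∧ (su , any⁺ (λ x → lookup S x ∧ adj G u x) (lose (∈-allFin _) (from T-∧ (sw , uw))))

  minL-map-≤ : ∀ {A : Set} (f : A → ℕ) {xs y} → y ∈ xs → minL G (map f xs) ≤ f y
  minL-map-≤ f {x ∷ xs} {y} y∈ =
    foldr-preservesᵒ {P = _≤ f y} (λ a b → [ m≤n⇒m⊓o≤n b , m≤n⇒o⊓m≤n a ]) (f x) (map f xs) (located y∈)
    where
    located : y ∈ x ∷ xs → f x ≤ f y ⊎ Any (_≤ f y) (map f xs)
    located (here refl)  = inj₁ ≤-refl
    located (there y∈xs) = inj₂ (map⁺ (Any.map (λ { refl → ≤-refl }) y∈xs))

  2^minL-map-≤ : ∀ {A : Set} (f : A → ℕ) (xs : List A) {m} → 1 ≤ m →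
    (∀ {x} → x ∈ xs → ∃[ y ] y ∈ xs × 2 ^ f y ≤ m) → 2 ^ minL G (map f xs) ≤ m
  2^minL-map-≤ f []       1≤m _    = 1≤m
  2^minL-map-≤ f (x ∷ xs) _   pick with pick (here refl)
  ... | y , y∈ , 2^fy≤m = ≤-trans (^-monoʳ-≤ 2 (minL-map-≤ f y∈)) 2^fy≤m

module _ {n : ℕ} (G : Graph n) (free : 2K₂-free G) where

  edgeCount-deleteN : ∀ S {v z₀} → T (lookup S v) → T (lookup S z₀) → T (adj G v z₀) →
    (∀ u w → T (lookup S u) → T (lookup S w) → T (adj G u w) → deg G (lookup S) u ≤ deg G (lookup S) v) →
    (∀ z → T (lookup S z) → T (adj G v z) →
       deg G (lookup (deleteN G S v)) z₀ ≤ deg G (lookup (deleteN G S v)) z) →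
    2 * suc (edgeCount G (deleteN G S v)) ≤ edgeCount G S
  edgeCount-deleteN S {v} {z₀} v∈S z₀∈S v~z₀ v-maxdeg z₀-mindeg = begin
    2 * suc (edges G h h)
      ≡⟨ double (edges G h h) ⟩
    edges G h h + edges G h h + (1 + 1)
      ≤⟨ +-mono-≤ (+-monoʳ-≤ (edges G h h) H-edges) (+-mono-≤ (edge⇒1≤edges G {N} {δ} z₀∈N (fromWitness refl) z₀~v)
                                                               (edge⇒1≤edges G {δ} {N} (fromWitness refl) z₀∈N v~z₀)) ⟩
    edges G h h + (edges G N h + edges G N h) + (edges G N δ + edges G δ N)
      ≡⟨ regroup (edges G h h) (edges G N h) (edges G N δ) (edges G δ N) ⟩
    edges G h h + edges G N h + (edges G N h + edges G N δ) + edges G δ N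
      ≡⟨ cong (λ e → edges G h h + e + (edges G N h + edges G N δ) + edges G δ N) (edges-comm G N h) ⟩
    edges G h h + edges G h N + (edges G N h + edges G N δ) + edges G δ N
      ≤⟨ decomposition ⟩
    edgeCount G S ∎
    where
    open ≤-Reasoning
    s h N δ hz : Fin n → Bool
    s = lookup S
    h = lookup (deleteN G S v)
    N a = s a ∧ adj G v a
    δ a = ⌊ a ≟ v ⌋
    hz a = h a ∧ adj G z₀ a

    double : ∀ m → 2 * suc m ≡ m + m + (1 + 1)
    double = solve-∀
    regroup : ∀ m x a b → m + (x + x) + (a + b) ≡ m + x + (x + a) + b
    regroup = solve-∀

    z₀∈N : T (N z₀)
    z₀∈N = from T-∧ (z₀∈S , v~z₀)
    z₀~v : T (adj G z₀ v)
    z₀~v = subst T (Graph.sym G v z₀) v~z₀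

    partition : ∀ a → 𝟙 (h a) + 𝟙 (N a) + 𝟙 (δ a) ≤ 𝟙 (s a)
    partition = deleteN-partition G S v v∈S

    decomposition : edges G h h + edges G h N + (edges G N h + edges G N δ) + edges G δ N ≤ edges G s s
    decomposition = ≤-trans (+-mono-≤ (+-mono-≤ H-row N-row) v-row) (edges-split₃ˡ G {h} {N} {δ} s partition)
      where
      H-row : edges G h h + edges G h N ≤ edges G h s
      H-row = m+n≤o⇒m≤o _ (edges-split₃ʳ G {h} {N} {δ} h partition)
      N-row : edges G N h + edges G N δ ≤ edges G N s
      N-row = ≤-trans (+-monoˡ-≤ (edges G N δ) (m≤m+n (edges G N h) (edges G N N)))
                      (edges-split₃ʳ G {h} {N} {δ} N partition)
      v-row : edges G δ N ≤ edges G δ s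
      v-row = m+n≤o⇒n≤o (edges G δ h) (m+n≤o⇒m≤o _ (edges-split₃ʳ G {h} {N} {δ} δ partition))

    z₀-covers : ∀ a b → T (h a) → T (h b) → T (adj G a b) → T (hz a) ⊎ T (hz b)
    z₀-covers a b ha hb ab with adj G z₀ a in z₀a | adj G z₀ b in z₀b
    ... | true  | _     = inj₁ (from T-∧ (ha , tt))
    ... | false | true  = inj₂ (from T-∧ (hb , tt))
    ... | false | false = ⊥-elim (free v z₀ a b (to T-≡ v~z₀) (to T-≡ ab)
                            (proj₂ (∈-deleteN G S v a ha)) (proj₂ (∈-deleteN G S v b hb)) z₀a z₀b)

    edges-hz-h≤edges-N-h : edges G hz h ≤ edges G N h
    edges-hz-h≤edges-N-h = begin
      edges G hz h                         ≤⟨ edges-≤ G deg≤Δ ⟩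
      deg G h z₀ * deg G s v               ≡⟨ *-comm (deg G h z₀) (deg G s v) ⟩
      deg G s v * deg G h z₀               ≤⟨ edges-≥ G (λ a Na → uncurry (z₀-mindeg a) (to T-∧ Na)) ⟩
      edges G N h                          ∎
      where
      deg≤Δ : ∀ a → T (hz a) → deg G h a ≤ deg G s v
      deg≤Δ a hza with to T-∧ hza
      ... | ha , z₀a = ≤-trans (deg-mono G (λ {x} hx → proj₁ (∈-deleteN G S v x hx)) a)
                               (v-maxdeg a z₀ (proj₁ (∈-deleteN G S v a ha)) z₀∈S
                                 (subst T (Graph.sym G z₀ a) z₀a))

    H-edges : edges G h h ≤ edges G N h + edges G N h
    H-edges = begin
      edges G h h              ≤⟨ edges-cover G z₀-covers ⟩
      edges G hz h + edges G h hz ≡⟨ cong (edges G hz h +_) (edges-comm G h hz) ⟩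
      edges G hz h + edges G hz h ≤⟨ +-mono-≤ edges-hz-h≤edges-N-h edges-hz-h≤edges-N-h ⟩
      edges G N h + edges G N h ∎

  θ-step : ∀ S {v a b} → T (nonIsolated G S v) →
    (∀ u → T (nonIsolated G S u) → deg G (lookup S) u ≤ deg G (lookup S) v) →
    2 ^ a ≤ 1 ⊔ edgeCount G (delete G S v) → 2 ^ b ≤ 1 ⊔ edgeCount G (deleteN G S v) →
    2 ^ (a ⊔ suc b) ≤ 1 ⊔ edgeCount G S
  θ-step S {v} {a} {b} v-ni v-max 2^a≤ 2^b≤ = begin
    2 ^ (a ⊔ suc b)     ≡⟨ mono-≤-distrib-⊔ (^-monoʳ-≤ 2) a (suc b) ⟩
    2 ^ a ⊔ 2 ^ suc b   ≤⟨ ⊔-lub deleted contracted ⟩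
    1 ⊔ edgeCount G S   ∎
    where
    open ≤-Reasoning
    h : Fin n → Bool
    h = lookup (deleteN G S v)

    deleted : 2 ^ a ≤ 1 ⊔ edgeCount G S
    deleted = ≤-trans 2^a≤ (⊔-monoʳ-≤ 1 (edges-mono G (∈-delete G S v) (∈-delete G S v)))

    contracted : 2 ^ suc b ≤ 1 ⊔ edgeCount G S
    contracted with nonIsolated⇒neighbour G S v-ni
    ... | z , v~z with ∃-argmin (λ z → lookup S z ∧ adj G v z) (deg G h) v~z
    ...   | z₀ , v~z₀ , z₀-min = begin
      2 * 2 ^ b                         ≤⟨ *-monoʳ-≤ 2 (≤-trans 2^b≤ (m⊔n≤m+n 1 (edgeCount G (deleteN G S v)))) ⟩
      2 * suc (edgeCount G (deleteN G S v)) ≤⟨ edgeCount-deleteN S (proj₁ (to T-∧ v-ni))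
                                                 (proj₁ (to T-∧ v~z₀)) (proj₂ (to T-∧ v~z₀))
                                                 (λ u w su sw uw → v-max u (edge⇒nonIsolated G S su sw uw))
                                                 (λ z sz vz → z₀-min z (from T-∧ (sz , vz))) ⟩
      edgeCount G S                     ≤⟨ m≤n⊔m 1 (edgeCount G S) ⟩
      1 ⊔ edgeCount G S                 ∎

  θ-aux-bound : ∀ k S → 2 ^ θ-aux G k S ≤ 1 ⊔ edgeCount G S
  θ-aux-bound zero    S = m≤m⊔n 1 (edgeCount G S)
  θ-aux-bound (suc k) S = 2^minL-map-≤ G branch candidates (m≤m⊔n 1 (edgeCount G S)) pick
    where
    branch : Fin n → ℕ
    branch v = θ-aux G k (delete G S v) ⊔ suc (θ-aux G k (deleteN G S v))
    candidates : List (Fin n)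
    candidates = filter (T? ∘ nonIsolated G S) (allFin n)
    pick : ∀ {x} → x ∈ candidates → ∃[ v ] v ∈ candidates × 2 ^ branch v ≤ 1 ⊔ edgeCount G S
    pick x∈ with ∃-argmax (nonIsolated G S) (deg G (lookup S)) (proj₂ (∈-filter⁻ _ {xs = allFin n} x∈))
    ... | v , v-ni , v-max =
      v , ∈-filter⁺ _ (∈-allFin v) v-ni , θ-step S {v} {θ-aux G k (delete G S v)} {θ-aux G k (deleteN G S v)} v-ni v-max
        (θ-aux-bound k (delete G S v)) (θ-aux-bound k (deleteN G S v))

theorem46 : (n : ℕ) → 1 ≤ n → (G : Graph n) → 2K₂-free G → 2 ^ θ G ≤ n * n
theorem46 n 1≤n G free = begin
  2 ^ θ G            ≤⟨ θ-aux-bound G free n ⊤ ⟩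
  1 ⊔ edgeCount G ⊤  ≤⟨ ⊔-lub (*-mono-≤ 1≤n 1≤n) (edges≤n*n G (lookup ⊤) (lookup ⊤)) ⟩
  n * n              ∎
  where open ≤-Reasoning
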